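{- Let $\mathbf S=(S,\wedge,0)$ be an atomic meet-semilattice with least element $0$, and let $\operatorname{At}\mathbf S$ denote the set of all atoms of $\mathbf S$. Then the lattice $\mathbf{Cl}(\mathbf S)=(\mathrm{Cl}(\mathbf S),\subseteq)$ of closed subsets of $S$ is isomorphic to the Boolean algebra $(2^{\operatorname{At}\mathbf S},\subseteq)$ of all subsets of $\operatorname{At}\mathbf S$.
   Context: For a meet-semilattice $\mathbf S=(S,\wedge,0)$ with least element $0$, the orthogonality relation on $S$ is defined by $x\perp y$ iff $x\wedge y=0$. For $A\subseteq S$ put $A^\perp:=\{x\in S\mid x\perp y\text{ for all }y\in A\}$. A subset $A\subseteq S$ is called closed if $A^{\perp\perp}=A$; $\mathrm{Cl}(\mathbf S)$ is the set of all closed subsets of $S$, ordered by inclusion. $\mathbf S$ is atomic if every nonzero element lies above some atom (an atom being a minimal element of $S\setminus\{0\}$). -}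

module Defs where

open import Level using (Level; _⊔_)
open import Relation.Binary.Core using (Rel)
open import Relation.Binary.Lattice.Bundles using (MeetSemilattice)
open import Relation.Unary using (Pred; _⊆_)
open import Data.Product using (Σ; ∃; _×_; _,_; proj₁)
open import Relation.Nullary using (¬_)

-- An order isomorphism between two preordered types: mutually inverse
-- monotone maps, where "inverse" is up to the equivalence induced by the
-- order (for the inclusion orders used below this is extensional equality
-- of subsets).
record OrderIso {a b r s} (A : Set a) (_≤A_ : Rel A r)
                (B : Set b) (_≤B_ : Rel B s) : Set (a ⊔ b ⊔ r ⊔ s) where
  field
    to      : A → B
    from    : B → A
    to-mono   : ∀ {x y} → x ≤A y → to x ≤B to y
    from-mono : ∀ {x y} → x ≤B y → from x ≤A from y
    from∘to : ∀ x → (from (to x) ≤A x) × (x ≤A from (to x))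
    to∘from : ∀ y → (to (from y) ≤B y) × (y ≤B to (from y))

module _ {c ℓ₁ ℓ₂} (M : MeetSemilattice c ℓ₁ ℓ₂) where
  open MeetSemilattice M renaming (Carrier to S)

  Lvl : Level
  Lvl = c ⊔ ℓ₁ ⊔ ℓ₂

  module WithZero (0# : S) where

    _⊥_ : S → S → Set ℓ₁
    x ⊥ y = (x ∧ y) ≈ 0#

    _ᵖ : Pred S Lvl → Pred S Lvl
    (A ᵖ) x = ∀ y → A y → x ⊥ y

    IsClosed : Pred S Lvl → Set Lvl
    IsClosed A = (((A ᵖ) ᵖ) ⊆ A) × (A ⊆ ((A ᵖ) ᵖ))

    IsAtom : S → Set Lvl
    IsAtom a = (¬ (a ≈ 0#)) × (∀ x → ¬ (x ≈ 0#) → x ≤ a → x ≈ a)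

    Atomic : Set Lvl
    Atomic = ∀ x → ¬ (x ≈ 0#) → ∃ λ a → IsAtom a × (a ≤ x)

    Cl : Set (Level.suc Lvl)
    Cl = Σ (Pred S Lvl) IsClosed

    _⊆Cl_ : Rel Cl Lvl
    A ⊆Cl B = proj₁ A ⊆ proj₁ B

    -- 2^At(S): subsets of the set of atoms (as subsets of the setoid S,
    -- i.e. respecting ≈)
    AtSubset : Set (Level.suc Lvl)
    AtSubset = Σ (Pred S Lvl) λ B → (B ⊆ IsAtom) × (∀ {x y} → x ≈ y → B x → B y)

    _⊆At_ : Rel AtSubset Lvl
    A ⊆At B = proj₁ A ⊆ proj₁ B

-- A closed set is down-closed, and in an atomic semilattice an element is
-- orthogonal to y as soon as every atom below it is; hence a closed set A is
-- recovered as the double orthogonal of its atoms. Conversely, for a set B of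
-- atoms, an atom outside B is orthogonal to all of B (distinct atoms meet in
-- 0), so the only atoms in B^⊥⊥ are those of B. Thus A ↦ A ∩ At and
-- B ↦ B^⊥⊥ are mutually inverse monotone maps.
module Submission where

open import Defs
open import Level using (Level; _⊔_; Lift; lift; lower)
open import Relation.Binary.Lattice.Bundles using (MeetSemilattice)
import Relation.Binary.Lattice.Properties.MeetSemilattice as MeetSemilatticeProperties
open import Axiom.ExcludedMiddle using (ExcludedMiddle)
open import Axiom.DoubleNegationElimination using (em⇒dne)
open import Data.Product using (_×_; _,_; proj₁; proj₂)
open import Relation.Nullary using (¬_)
open import Relation.Unary using (Pred; _⊆_)

module ClosedSets {c ℓ₁ ℓ₂} (M : MeetSemilattice c ℓ₁ ℓ₂)
                  (0# : MeetSemilattice.Carrier M)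
                  (0-least : ∀ x → MeetSemilattice._≤_ M 0# x) where

  open MeetSemilattice M renaming (Carrier to S)
  open MeetSemilatticeProperties M using (∧-comm; ∧-monotonic)
  open WithZero M 0#

  private
    L : Level
    L = Lvl M

  ≤0⇒≈0 : ∀ {x} → x ≤ 0# → x ≈ 0#
  ≤0⇒≈0 {x} x≤0 = antisym x≤0 (0-least x)

  ⊥-sym : ∀ {x y} → x ⊥ y → y ⊥ x
  ⊥-sym {x} {y} x⊥y = Eq.trans (∧-comm y x) x⊥y

  ⊥-downward : ∀ {x x′ y} → x ≤ x′ → x′ ⊥ y → x ⊥ y
  ⊥-downward x≤x′ x′⊥y = ≤0⇒≈0 (trans (∧-monotonic x≤x′ refl) (reflexive x′⊥y))

  ≤-⊥⇒≈0 : ∀ {x y} → x ≤ y → x ⊥ y → x ≈ 0#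
  ≤-⊥⇒≈0 x≤y x⊥y = ≤0⇒≈0 (trans (∧-greatest refl x≤y) (reflexive x⊥y))

  ᵖ-antitone : ∀ {A B : Pred S L} → A ⊆ B → (B ᵖ) ⊆ (A ᵖ)
  ᵖ-antitone A⊆B x∈Bᵖ y y∈A = x∈Bᵖ y (A⊆B y∈A)

  ᵖᵖ-monotone : ∀ {A B : Pred S L} → A ⊆ B → ((A ᵖ) ᵖ) ⊆ ((B ᵖ) ᵖ)
  ᵖᵖ-monotone A⊆B = ᵖ-antitone (ᵖ-antitone A⊆B)

  ⊆ᵖᵖ : ∀ {A : Pred S L} → A ⊆ ((A ᵖ) ᵖ)
  ⊆ᵖᵖ x∈A y y∈Aᵖ = ⊥-sym (y∈Aᵖ _ x∈A)

  ᵖᵖ-isClosed : ∀ {A : Pred S L} → IsClosed ((A ᵖ) ᵖ)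
  ᵖᵖ-isClosed {A} = ᵖ-antitone (⊆ᵖᵖ {A ᵖ}) , ⊆ᵖᵖ

  DownClosed : Pred S L → Set L
  DownClosed A = ∀ {x y} → y ≤ x → A x → A y

  ᵖ-downClosed : ∀ {A : Pred S L} → DownClosed (A ᵖ)
  ᵖ-downClosed y≤x x∈Aᵖ z z∈A = ⊥-downward y≤x (x∈Aᵖ z z∈A)

  closed⇒downClosed : ∀ {A : Pred S L} → IsClosed A → DownClosed A
  closed⇒downClosed (Aᵖᵖ⊆A , A⊆Aᵖᵖ) y≤x x∈A = Aᵖᵖ⊆A (ᵖ-downClosed y≤x (A⊆Aᵖᵖ x∈A))

  closed-resp-≈ : ∀ {A : Pred S L} → IsClosed A → ∀ {x y} → x ≈ y → A x → A y
  closed-resp-≈ A-closed x≈y = closed⇒downClosed A-closed (reflexive (Eq.sym x≈y))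

  isAtom-resp-≈ : ∀ {x y} → x ≈ y → IsAtom x → IsAtom y
  isAtom-resp-≈ x≈y (x≉0 , x-minimal) =
    (λ y≈0 → x≉0 (Eq.trans x≈y y≈0)) ,
    (λ z z≉0 z≤y → Eq.trans (x-minimal z z≉0 (trans z≤y (reflexive (Eq.sym x≈y)))) x≈y)

  atomsOf : Cl → AtSubset
  atomsOf (A , A-closed) =
    (λ x → A x × IsAtom x) , proj₂ ,
    λ x≈y (x∈A , x-atom) → closed-resp-≈ A-closed x≈y x∈A , isAtom-resp-≈ x≈y x-atom

  closure : AtSubset → Cl
  closure (B , _) = (B ᵖ) ᵖ , ᵖᵖ-isClosed

  module Classical (em : ExcludedMiddle L) where

    dne : ∀ {P : Set L} → ¬ ¬ P → P
    dne = em⇒dne em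

    ≈-stable : ∀ {x y} → ¬ ¬ (x ≈ y) → x ≈ y
    ≈-stable {x} {y} ¬¬x≈y = lower (dne {Lift L (x ≈ y)} λ ¬x≈y → ¬¬x≈y (λ x≈y → ¬x≈y (lift x≈y)))

    distinct-atoms-⊥ : ∀ {a b} → IsAtom a → IsAtom b → ¬ (a ≈ b) → a ⊥ b
    distinct-atoms-⊥ {a} {b} (_ , a-minimal) (_ , b-minimal) a≉b = ≈-stable λ a∧b≉0 →
      a≉b (Eq.trans (Eq.sym (a-minimal (a ∧ b) a∧b≉0 (x∧y≤x a b)))
                    (b-minimal (a ∧ b) a∧b≉0 (x∧y≤y a b)))

    atom∈ᵖᵖ⇒∈ : ∀ (B : AtSubset) {a} → IsAtom a → ((proj₁ B ᵖ) ᵖ) a → proj₁ B a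
    atom∈ᵖᵖ⇒∈ (B , B⊆atoms , B-resp-≈) a-atom a∈Bᵖᵖ = dne λ a∉B →
      proj₁ a-atom (≤-⊥⇒≈0 refl (a∈Bᵖᵖ _ λ b b∈B →
        distinct-atoms-⊥ a-atom (B⊆atoms b∈B) λ a≈b → a∉B (B-resp-≈ (Eq.sym a≈b) b∈B)))

    module _ (atomic : Atomic) where

      ⊥-fromAtomsBelow : ∀ {x y} → (∀ a → IsAtom a → a ≤ x → a ⊥ y) → x ⊥ y
      ⊥-fromAtomsBelow {x} {y} atoms-below-⊥ = ≈-stable λ x∧y≉0 →
        let (a , a-atom , a≤x∧y) = atomic (x ∧ y) x∧y≉0
        in proj₁ a-atom (≤-⊥⇒≈0 (trans a≤x∧y (x∧y≤y x y))
                                 (atoms-below-⊥ a a-atom (trans a≤x∧y (x∧y≤x x y))))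

      downClosed⊆atomsᵖᵖ : ∀ {A : Pred S L} → DownClosed A →
                           A ⊆ (((λ x → A x × IsAtom x) ᵖ) ᵖ)
      downClosed⊆atomsᵖᵖ A-down x∈A y y⊥atoms =
        ⊥-fromAtomsBelow λ a a-atom a≤x → ⊥-sym (y⊥atoms a (A-down a≤x x∈A , a-atom))

      Cl≅AtSubset : OrderIso Cl _⊆Cl_ AtSubset _⊆At_
      Cl≅AtSubset = record
        { to        = atomsOf
        ; from      = closure
        ; to-mono   = λ A⊆B (x∈A , x-atom) → A⊆B x∈A , x-atom
        ; from-mono = ᵖᵖ-monotone
        ; from∘to   = λ (A , A-closed) →
            (λ x∈closure → proj₁ A-closed (ᵖᵖ-monotone proj₁ x∈closure)) ,
            downClosed⊆atomsᵖᵖ (closed⇒downClosed A-closed)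
        ; to∘from   = λ B →
            (λ (a∈Bᵖᵖ , a-atom) → atom∈ᵖᵖ⇒∈ B a-atom a∈Bᵖᵖ) ,
            (λ a∈B → ⊆ᵖᵖ a∈B , proj₁ (proj₂ B) a∈B)
        }

theorem1 : ∀ {c ℓ₁ ℓ₂} → ExcludedMiddle (c ⊔ ℓ₁ ⊔ ℓ₂) →
    (M : MeetSemilattice c ℓ₁ ℓ₂) →
    (0# : MeetSemilattice.Carrier M) →
    (∀ x → MeetSemilattice._≤_ M 0# x) →
    WithZero.Atomic M 0# →
    OrderIso (WithZero.Cl M 0#) (WithZero._⊆Cl_ M 0#)
    (WithZero.AtSubset M 0#) (WithZero._⊆At_ M 0#)
theorem1 em M 0# 0-least atomic =
  ClosedSets.Classical.Cl≅AtSubset M 0# 0-least em atomic
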